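{- Let $k\ge 2$ and let $p=\left(1-2^{ -2k/\alpha(n)}\right)^{1/k}$ with $\alpha(n)=\omega(1)$ and $n$ large enough that $p\le 1/2$. Let $Q:\{0,1\}^k\to\mathbb{R}$ be a probability distribution such that $Q(1^k)=0$ and such that for every $i\in[k]$, marginalizing out the $i$-th bit of $Q$ yields the distribution of $k-1$ independent bits each equal to $1$ with probability $p$. Then $Q=\mathcal{P}_k$, where $\mathcal{P}_k(x)=p^m(1-p)^{k-m}-(-1)^{k-m}p^k$ and $m$ denotes the number of ones in $x$.
   Context: $\mathcal{P}_k$ is the distribution on $\{0,1\}^k$ given by the displayed formula; it arises as the per-coordinate distribution of $k$ planted vectors obtained by taking $k$ independent $p$-biased bits, letting $m$ be their number of ones, and, if $k-m$ is even, flipping the last bit with probability $(p/(1-p))^{k-m}$. -}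

module Defs where


open import Data.Bool using (Bool; true; false; if_then_else_)
open import Data.Nat using (ℕ; zero; suc; _∸_)
open import Data.Fin using (Fin)
open import Data.Vec using (Vec; []; _∷_; insertAt)
open import Data.Unit.Polymorphic using (⊤)
open import Algebra.Bundles using (CommutativeRing)

-- Everything is stated over an arbitrary commutative ring R (the paper uses ℝ).
module _ {c ℓ} (R : CommutativeRing c ℓ) where
  open CommutativeRing R hiding (zero)

  pow : Carrier → ℕ → Carrier
  pow x zero    = 1#
  pow x (suc n) = x * pow x n

  ones : ∀ {n} → Vec Bool n → ℕ
  ones []           = zero
  ones (true  ∷ xs) = suc (ones xs)
  ones (false ∷ xs) = ones xs

  iid : Carrier → ∀ {n} → Vec Bool n → Carrier
  iid p []       = 1#
  iid p (b ∷ bs) = (if b then p else (1# - p)) * iid p bs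

  sumAll : ∀ n → (Vec Bool n → Carrier) → Carrier
  sumAll zero    f = f []
  sumAll (suc n) f = sumAll n (λ v → f (false ∷ v)) + sumAll n (λ v → f (true ∷ v))

  Marginals : ∀ k → Carrier → (Vec Bool k → Carrier) → Set ℓ
  Marginals zero    p Q = ⊤
  Marginals (suc n) p Q =
    ∀ (i : Fin (suc n)) (y : Vec Bool n) →
      (Q (insertAt y i false) + Q (insertAt y i true)) ≈ iid p y

  𝒫 : Carrier → ∀ k → Vec Bool k → Carrier
  𝒫 p k x =
    (pow p (ones x) * pow (1# - p) (k ∸ ones x)) - (pow (- 1#) (k ∸ ones x) * pow p k)

{-# OPTIONS --safe #-}
-- Fixing the first bit to 1 turns Q into p times a function with the same
-- constraints on one bit fewer, and the marginal over the first bit then gives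
-- Q (0 ∷ y) = iid y - Q (1 ∷ y).  So, by induction on k for functions of
-- arbitrary total mass m, Q is determined by Q (1ᵏ) = 0 and its marginals alone;
-- 𝒫 satisfies the same recursion, 𝒫 (1 ∷ y) = p 𝒫 y and
-- 𝒫 (0 ∷ y) + 𝒫 (1 ∷ y) = iid y.
module Submission where

open import Defs
open import Data.Bool using (Bool; true; false)
open import Data.Nat using (ℕ; _≤_; zero; suc; _∸_; z≤n; s≤s)
open import Data.Nat.Properties using (+-∸-assoc; m≤n⇒m≤1+n)
open import Data.Fin as Fin using (Fin)
open import Data.Vec using (Vec; replicate; []; _∷_; insertAt)
open import Data.Unit.Polymorphic using (⊤; tt)
open import Algebra.Bundles using (CommutativeRing)
open import Relation.Binary.PropositionalEquality using (_≡_)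

module _ {c ℓ} (R : CommutativeRing c ℓ) where
  open CommutativeRing R hiding (zero)
  open import Algebra.Properties.Ring ring using (x[y-z]≈xy-xz; -‿distribˡ-*; -1*x≈-x)
  open import Algebra.Properties.AbelianGroup +-abelianGroup
    using (⁻¹-involutive; x≈z//y; //-rightDividesˡ; //-rightDividesʳ)
  open import Algebra.Properties.CommutativeSemigroup +-commutativeSemigroup
    using (interchange)
  open import Algebra.Properties.CommutativeSemigroup *-commutativeSemigroup
    using (x∙yz≈y∙xz)
  open import Relation.Binary.Reasoning.Setoid setoid

  ones≤length : ∀ {n} (x : Vec Bool n) → ones R x ≤ n
  ones≤length []          = z≤n
  ones≤length (true ∷ x)  = s≤s (ones≤length x)
  ones≤length (false ∷ x) = m≤n⇒m≤1+n (ones≤length x)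

  suc∸ones : ∀ {n} (x : Vec Bool n) → suc n ∸ ones R x ≡ suc (n ∸ ones R x)
  suc∸ones x = +-∸-assoc 1 (ones≤length x)

  module _ (p : Carrier) where

    iid≈pow-ones : ∀ {n} (x : Vec Bool n) →
      iid R p x ≈ pow R p (ones R x) * pow R (1# - p) (n ∸ ones R x)
    iid≈pow-ones []          = sym (*-identityˡ 1#)
    iid≈pow-ones (true ∷ x)  = trans (*-congˡ (iid≈pow-ones x)) (sym (*-assoc _ _ _))
    iid≈pow-ones (false ∷ x) rewrite suc∸ones x =
      trans (*-congˡ (iid≈pow-ones x)) (x∙yz≈y∙xz _ _ _)

    𝒫-[] : 𝒫 R p 0 [] ≈ 0#
    𝒫-[] = -‿inverseʳ (1# * 1#)

    𝒫-true : ∀ {n} (y : Vec Bool n) → 𝒫 R p (suc n) (true ∷ y) ≈ p * 𝒫 R p n y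
    𝒫-true {n} y = begin
      (p * a) * b - s * (p * pⁿ)  ≈⟨ +-cong (*-assoc p a b) (-‿cong (x∙yz≈y∙xz s p pⁿ)) ⟩
      p * (a * b) - p * (s * pⁿ)  ≈⟨ x[y-z]≈xy-xz p (a * b) (s * pⁿ) ⟨
      p * (a * b - s * pⁿ)        ∎
      where
      a b s pⁿ : Carrier
      a  = pow R p (ones R y)
      b  = pow R (1# - p) (n ∸ ones R y)
      s  = pow R (- 1#) (n ∸ ones R y)
      pⁿ = pow R p n

    𝒫-marginal-head : ∀ {n} (y : Vec Bool n) →
      𝒫 R p (suc n) (false ∷ y) + 𝒫 R p (suc n) (true ∷ y) ≈ iid R p y
    𝒫-marginal-head {n} y rewrite suc∸ones y = begin
      (a * ((1# - p) * b) - (- 1# * s) * pⁿ⁺¹) + ((p * a) * b - s * pⁿ⁺¹)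
        ≈⟨ +-congʳ (+-cong (x∙yz≈y∙xz a (1# - p) b) (-‿cong minus-one)) ⟩
      ((1# - p) * (a * b) - - (s * pⁿ⁺¹)) + ((p * a) * b - s * pⁿ⁺¹)
        ≈⟨ +-cong (+-congˡ (⁻¹-involutive (s * pⁿ⁺¹))) (+-congʳ (*-assoc p a b)) ⟩
      ((1# - p) * (a * b) + s * pⁿ⁺¹) + (p * (a * b) - s * pⁿ⁺¹)
        ≈⟨ interchange _ _ _ _ ⟩
      ((1# - p) * (a * b) + p * (a * b)) + (s * pⁿ⁺¹ - s * pⁿ⁺¹)
        ≈⟨ +-cong (sym (distribʳ (a * b) (1# - p) p)) (-‿inverseʳ (s * pⁿ⁺¹)) ⟩
      ((1# - p) + p) * (a * b) + 0#
        ≈⟨ +-identityʳ _ ⟩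
      ((1# - p) + p) * (a * b)
        ≈⟨ *-congʳ (//-rightDividesˡ p 1#) ⟩
      1# * (a * b)
        ≈⟨ *-identityˡ (a * b) ⟩
      a * b
        ≈⟨ iid≈pow-ones y ⟨
      iid R p y ∎
      where
      a b s pⁿ⁺¹ : Carrier
      a    = pow R p (ones R y)
      b    = pow R (1# - p) (n ∸ ones R y)
      s    = pow R (- 1#) (n ∸ ones R y)
      pⁿ⁺¹ = pow R p (suc n)
      minus-one : (- 1# * s) * pⁿ⁺¹ ≈ - (s * pⁿ⁺¹)
      minus-one = trans (*-congʳ (-1*x≈-x s)) (sym (-‿distribˡ-* s pⁿ⁺¹))

    ScaledMarginals : ∀ n → Carrier → (Vec Bool n → Carrier) → Set ℓ
    ScaledMarginals zero    m Q = ⊤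
    ScaledMarginals (suc n) m Q =
      ∀ (i : Fin (suc n)) (y : Vec Bool n) →
        Q (insertAt y i false) + Q (insertAt y i true) ≈ m * iid R p y

    Marginals⇒ScaledMarginals : ∀ n Q → Marginals R n p Q → ScaledMarginals n 1# Q
    Marginals⇒ScaledMarginals zero    Q _         = tt
    Marginals⇒ScaledMarginals (suc n) Q marginals i y =
      trans (marginals i y) (sym (*-identityˡ _))

    ScaledMarginals-true : ∀ n m Q → ScaledMarginals (suc n) m Q →
                           ScaledMarginals n (m * p) (λ y → Q (true ∷ y))
    ScaledMarginals-true zero    m Q _         = tt
    ScaledMarginals-true (suc n) m Q marginals i y =
      trans (marginals (Fin.suc i) (true ∷ y)) (sym (*-assoc m p _))

    ScaledMarginals-unique : ∀ {n} m (Q : Vec Bool n → Carrier) →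
      Q (replicate n true) ≈ 0# → ScaledMarginals n m Q →
      ∀ x → Q x ≈ m * 𝒫 R p n x
    ScaledMarginals-unique m Q Q[1ⁿ]≈0 _ [] = begin
      Q []          ≈⟨ Q[1ⁿ]≈0 ⟩
      0#            ≈⟨ zeroʳ m ⟨
      m * 0#        ≈⟨ *-congˡ 𝒫-[] ⟨
      m * 𝒫 R p 0 [] ∎
    ScaledMarginals-unique {suc n} m Q Q[1ⁿ]≈0 marginals (b ∷ y) = Q≈m𝒫 b
      where
      𝒫₀ 𝒫₁ : Carrier
      𝒫₀ = 𝒫 R p (suc n) (false ∷ y)
      𝒫₁ = 𝒫 R p (suc n) (true ∷ y)

      Q-true : Q (true ∷ y) ≈ m * 𝒫₁
      Q-true = begin
        Q (true ∷ y)         ≈⟨ ScaledMarginals-unique (m * p) (λ y → Q (true ∷ y))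
                                   Q[1ⁿ]≈0 (ScaledMarginals-true n m Q marginals) y ⟩
        (m * p) * 𝒫 R p n y  ≈⟨ *-assoc m p _ ⟩
        m * (p * 𝒫 R p n y)  ≈⟨ *-congˡ (𝒫-true y) ⟨
        m * 𝒫₁               ∎

      Q≈m𝒫 : ∀ b → Q (b ∷ y) ≈ m * 𝒫 R p (suc n) (b ∷ y)
      Q≈m𝒫 true  = Q-true
      Q≈m𝒫 false = begin
        Q (false ∷ y)                 ≈⟨ x≈z//y _ _ _ (marginals Fin.zero y) ⟩
        m * iid R p y - Q (true ∷ y)  ≈⟨ +-cong (*-congˡ (sym (𝒫-marginal-head y))) (-‿cong Q-true) ⟩
        m * (𝒫₀ + 𝒫₁) - m * 𝒫₁        ≈⟨ +-congʳ (distribˡ m 𝒫₀ 𝒫₁) ⟩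
        (m * 𝒫₀ + m * 𝒫₁) - m * 𝒫₁    ≈⟨ //-rightDividesʳ (m * 𝒫₁) (m * 𝒫₀) ⟩
        m * 𝒫₀                        ∎

theorem7 : ∀ {c ℓ} (R : CommutativeRing c ℓ) (k : ℕ) → 2 ≤ k →
    (p : CommutativeRing.Carrier R) →
    (Q : Vec Bool k → CommutativeRing.Carrier R) →
    CommutativeRing._≈_ R (sumAll R k Q) (CommutativeRing.1# R) →
    CommutativeRing._≈_ R (Q (replicate k true)) (CommutativeRing.0# R) →
    Marginals R k p Q →
    ∀ (x : Vec Bool k) → CommutativeRing._≈_ R (Q x) (𝒫 R p k x)
theorem7 R k _ p Q _ Q[1ᵏ]≈0 marginals x =
  trans (ScaledMarginals-unique R p 1# Q Q[1ᵏ]≈0 (Marginals⇒ScaledMarginals R p k Q marginals) x)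
        (*-identityˡ _)
  where open CommutativeRing R using (1#; trans; *-identityˡ)
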